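{- Let $T$ be a tree that is not a star. Then $h(T)\ge |E(T)|+\lceil \ell(T)/2\rceil$.
   Context: A directed 3-hypergraph $H=(V,F)$ consists of hyperarcs $u,v\to w$ (body $\{u,v\}$ of two distinct vertices, head $w$). The closure $cl_H(S)$ of $S\subseteq V$ is obtained by forward chaining: mark $S$; while some hyperarc $a,b\to c$ has $a,b$ marked and $c$ unmarked, mark $c$. $H$ represents the graph $G=(V,E)$ if for all distinct $u,v$: $(u,v)\in E\Rightarrow cl_H(\{u,v\})=V$ and $(u,v)\notin E\Rightarrow cl_H(\{u,v\})=\{u,v\}$. The hydra number $h(G)$ is the minimum number of hyperarcs of a directed 3-hypergraph on $V$ representing $G$. A star is a tree containing no path of length 3. $T^-$ denotes the tree obtained from $T$ by deleting all its leaves, and $\ell(T)$ is the number of leaves of $T^-$. -}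

module Defs where

open import Data.Nat using (ℕ; zero; suc; _+_; _<ᵇ_; ⌈_/2⌉)
open import Data.Bool using (Bool; true; false; T; if_then_else_; _∧_)
open import Data.Fin using (Fin; toℕ)
open import Data.List using (List; []; _∷_; _++_; [_]; length; map; allFin)
open import Data.Nat.ListAction using (sum)
open import Data.List.Relation.Unary.AllPairs using (AllPairs)
open import Data.List.Relation.Unary.Linked using (Linked)
open import Data.List.Relation.Unary.Unique.Propositional using (Unique)
open import Data.Product using (Σ; ∃; _×_; _,_)
open import Data.Sum using (_⊎_)
open import Relation.Binary.PropositionalEquality using (_≡_; _≢_)
open import Relation.Nullary using (¬_)

record Graph (n : ℕ) : Set where
  field
    adj    : Fin n → Fin n → Bool
    sym    : ∀ u v → adj u v ≡ adj v u
    irrefl : ∀ v → adj v v ≡ false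

open Graph public

Adj : ∀ {n} → Graph n → Fin n → Fin n → Set
Adj G u v = T (adj G u v)

data Walk {n} (G : Graph n) : Fin n → Fin n → Set where
  nil  : ∀ {v} → Walk G v v
  cons : ∀ {u w v} → Adj G u w → Walk G w v → Walk G u v

Connected : ∀ {n} → Graph n → Set
Connected G = ∀ u v → Walk G u v

-- a cycle: distinct vertices x, y₁, …, yₖ, z (k ≥ 1, so at least 3 vertices),
-- consecutive ones adjacent, and z adjacent to x
HasCycle : ∀ {n} → Graph n → Set
HasCycle {n} G =
  Σ (Fin n) λ x → Σ (Fin n) λ y → Σ (List (Fin n)) λ ys → Σ (Fin n) λ z →
    Unique (x ∷ y ∷ ys ++ [ z ]) × Linked (Adj G) (x ∷ y ∷ ys ++ [ z ]) × Adj G z x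

IsTree : ∀ {n} → Graph n → Set
IsTree G = Connected G × ¬ HasCycle G

HasP3 : ∀ {n} → Graph n → Set
HasP3 {n} G = Σ (Fin n) λ a → Σ (Fin n) λ b → Σ (Fin n) λ c → Σ (Fin n) λ d →
  Unique (a ∷ b ∷ c ∷ d ∷ []) × Adj G a b × Adj G b c × Adj G c d

IsStar : ∀ {n} → Graph n → Set
IsStar G = IsTree G × ¬ HasP3 G

count : ∀ {n} → (Fin n → Bool) → ℕ
count {n} p = sum (map (λ i → if p i then 1 else 0) (allFin n))

degree : ∀ {n} → Graph n → Fin n → ℕ
degree G v = count (adj G v)

numEdges : ∀ {n} → Graph n → ℕ
numEdges {n} G = sum (map (λ u → count (λ v → (toℕ u <ᵇ toℕ v) ∧ adj G u v)) (allFin n))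

isLeaf : ∀ {n} → Graph n → Fin n → Bool
isLeaf G v with degree G v
... | 1 = true
... | _ = false

-- vertices of T⁻ (T with all leaves deleted) : the non-leaves of T
inTminus : ∀ {n} → Graph n → Fin n → Bool
inTminus G v = if isLeaf G v then false else true

degreeTminus : ∀ {n} → Graph n → Fin n → ℕ
degreeTminus G v = count (λ u → adj G v u ∧ inTminus G u)

ell : ∀ {n} → Graph n → ℕ
ell G = count (λ v → inTminus G v ∧ isOne (degreeTminus G v))
  where
  isOne : ℕ → Bool
  isOne 1 = true
  isOne _ = false

record Hyperarc (n : ℕ) : Set where
  constructor _,_⇒_∣_
  field
    tail₁ tail₂ : Fin n
    head        : Fin n
    distinct    : tail₁ ≢ tail₂

open Hyperarc public

SameArc : ∀ {n} → Hyperarc n → Hyperarc n → Set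
SameArc e f = head e ≡ head f ×
  ((tail₁ e ≡ tail₁ f × tail₂ e ≡ tail₂ f) ⊎ (tail₁ e ≡ tail₂ f × tail₂ e ≡ tail₁ f))

Hypergraph : ℕ → Set
Hypergraph n = List (Hyperarc n)

-- the list lists each hyperarc at most once (so length = |F|)
NoDupArcs : ∀ {n} → Hypergraph n → Set
NoDupArcs H = AllPairs (λ e f → ¬ SameArc e f) H

open import Data.List.Membership.Propositional using (_∈_)

-- closure cl_H(S): least set containing S and closed under the hyperarcs
-- (exactly the set of vertices marked by forward chaining)
data InClosure {n} (H : Hypergraph n) (S : Fin n → Set) : Fin n → Set where
  base : ∀ {x} → S x → InClosure H S x
  step : ∀ (e : Hyperarc n) → e ∈ H →
         InClosure H S (tail₁ e) → InClosure H S (tail₂ e) →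
         InClosure H S (head e)

Pair : ∀ {n} → Fin n → Fin n → Fin n → Set
Pair u v x = x ≡ u ⊎ x ≡ v

Represents : ∀ {n} → Hypergraph n → Graph n → Set
Represents {n} H G = ∀ (u v : Fin n) → u ≢ v →
  (Adj G u v → ∀ w → InClosure H (Pair u v) w) ×
  (¬ Adj G u v → ∀ w → InClosure H (Pair u v) w → Pair u v w)

module Submission where

-- If forward chaining from a pair {u, v} reaches a vertex outside a set M ∋ u, v, it fires
-- an arc with both tails in M and head outside M.  The tails of that arc are adjacent, since
-- the closure of a non-edge is the non-edge itself, so the arc sits on an edge inside M.
--
-- As T is not a star, it has an edge bc between two non-leaves.  Give every hyperarc e two
-- slots (e, false) and (e, true); we fill 2|E(T)| + ℓ(T) distinct slots.  An edge uv fills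
-- both slots of an arc with body {u, v} whose head is neither u, v nor a leaf adjacent to
-- neither of them (M is that set, bc guarantees a vertex outside it, and uv is the only edge
-- inside it).  A leaf x of T⁻, with parent y, fills one more slot.  Chaining from {x, y} reaches
-- a leaf hanging at x, through an arc that either avoids x in its body (then x takes its false
-- slot) or sits on xy; in the latter case a further chaining step yields a second arc on an
-- edge xw with a different head, so one of them is not the arc of the edge xw, and x takes the
-- slot of it selected by sideBit.  Hence 2|E(T)| + ℓ(T) ≤ 2|F|.

open import Data.Bool using (Bool; true; false; T; T?; if_then_else_; _∧_)
open import Data.Bool.Properties using (T-≡; T-∧)
open import Data.Empty using (⊥-elim)
open import Data.Fin using (Fin; toℕ; _≟_; _<?_)
open import Data.Fin.Properties using (any?; <-cmp)
import Data.Fin.Properties as Finₚ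
open import Data.List using (List; []; _∷_; [_]; _++_; length; map; concatMap; allFin; find; fromMaybe)
open import Data.List.Membership.Propositional using (_∈_)
open import Data.List.Membership.Propositional.Properties
  using (∈-∃++; ∈-++⁻; ∈-++⁺ˡ; ∈-++⁺ʳ; ∈-allFin; ∈-concatMap⁻; ∈-map⁺)
open import Data.List.Properties using (length-++; length-++-sucʳ; length-map; map-cong)
open import Data.List.Relation.Binary.Disjoint.Propositional using (Disjoint)
open import Data.List.Relation.Unary.All as All using (All; []; _∷_)
import Data.List.Relation.Unary.All.Properties as All
open import Data.List.Relation.Unary.AllPairs as AllPairs using ([]; _∷_)
import Data.List.Relation.Unary.AllPairs.Properties as AllPairs
open import Data.List.Relation.Unary.Any using (here; there; satisfied)
open import Data.List.Relation.Unary.Linked using ([]; [-]; _∷_)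
open import Data.List.Relation.Unary.Unique.Propositional using (Unique)
open import Data.List.Relation.Unary.Unique.Propositional.Properties using (allFin⁺; concat⁺; ++⁺)
open import Data.Maybe using (Maybe; just; nothing)
open import Data.Nat using (ℕ; zero; suc; _+_; _≤_; _≤?_; _<_; _<ᵇ_; z≤n; s≤s; ⌈_/2⌉)
open import Data.Nat.ListAction using (sum)
open import Data.Nat.Properties
  using (<-asym; <ᵇ⇒<; ≤-trans; ≤-antisym; ≤-reflexive; m≤n+m; +-suc; +-assoc; +-identityʳ; ⌈n/2⌉-mono; module ≤-Reasoning)
open import Data.Product using (Σ; ∃; ∃-syntax; _×_; _,_; proj₁; proj₂; map₁)
open import Data.Sum using (_⊎_; inj₁; inj₂; [_,_]′)
open import Function.Bundles using (_⇔_; mk⇔; module Equivalence)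
open import Level using (0ℓ)
open import Relation.Binary.Definitions using (tri<; tri≈; tri>)
open import Relation.Binary.PropositionalEquality
  using (_≡_; _≢_; refl; sym; trans; cong; cong₂; subst; subst₂; module ≡-Reasoning)
open import Relation.Nullary using (¬_; contradiction; Dec; yes; no; does; ¬?; _×-dec_; _⊎-dec_)
open import Relation.Nullary.Decidable using (decidable-stable; dec-true; dec-false)
open import Relation.Unary using (Pred; Decidable)

open import Defs hiding (sym)
open Equivalence using (to; from)

module _ {A : Set} where

  Unique-⊆⇒length≤ : ∀ {xs ys : List A} → Unique xs → (∀ {x} → x ∈ xs → x ∈ ys) → length xs ≤ length ys
  Unique-⊆⇒length≤ {[]} _ _ = z≤n
  Unique-⊆⇒length≤ {x ∷ xs} (x∉xs ∷ uniq) xs⊆ys with ∈-∃++ (xs⊆ys (here refl))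
  ... | ys₁ , ys₂ , refl = ≤-trans (s≤s (Unique-⊆⇒length≤ uniq xs⊆ys₁ys₂)) (≤-reflexive (sym (length-++-sucʳ ys₁ x ys₂)))
    where
    xs⊆ys₁ys₂ : ∀ {y} → y ∈ xs → y ∈ ys₁ ++ ys₂
    xs⊆ys₁ys₂ y∈xs with ∈-++⁻ ys₁ (xs⊆ys (there y∈xs))
    ... | inj₁ y∈ys₁ = ∈-++⁺ˡ y∈ys₁
    ... | inj₂ (here refl) = ⊥-elim (All.lookup x∉xs y∈xs refl)
    ... | inj₂ (there y∈ys₂) = ∈-++⁺ʳ ys₁ y∈ys₂

  module _ {P : Pred A 0ℓ} (P? : Decidable P) where

    find-just : ∀ {xs x} → find P? xs ≡ just x → x ∈ xs × P x
    find-just {y ∷ xs} eq with P? y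
    find-just {y ∷ xs} refl | yes py = here refl , py
    ... | no _ = map₁ there (find-just eq)

    find-complete : ∀ {xs x} → x ∈ xs → P x → ∃[ y ] find P? xs ≡ just y
    find-complete {y ∷ xs} x∈ px with P? y
    ... | yes _ = y , refl
    find-complete {y ∷ xs} (here refl) px | no ¬py = ⊥-elim (¬py px)
    find-complete {y ∷ xs} (there x∈) px | no _ = find-complete x∈ px

    find-cong : ∀ {Q : Pred A 0ℓ} (Q? : Decidable Q) → (∀ {x} → P x → Q x) → (∀ {x} → Q x → P x) →
                ∀ xs → find P? xs ≡ find Q? xs
    find-cong Q? P⇒Q Q⇒P [] = refl
    find-cong Q? P⇒Q Q⇒P (y ∷ xs) with P? y | Q? y
    ... | yes _  | yes _  = refl
    ... | yes py | no ¬qy = ⊥-elim (¬qy (P⇒Q py))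
    ... | no ¬py | yes qy = ⊥-elim (¬py (Q⇒P qy))
    ... | no _   | no _   = find-cong Q? P⇒Q Q⇒P xs

module _ {A B : Set} where

  length-concatMap : ∀ (f : A → List B) xs → length (concatMap f xs) ≡ sum (map (λ x → length (f x)) xs)
  length-concatMap f [] = refl
  length-concatMap f (x ∷ xs) = trans (length-++ (f x)) (cong (length (f x) +_) (length-concatMap f xs))

module _ {B : Set} where

  Unique-concatMap-allFin : ∀ {k} (f : Fin k → List B) → (∀ i → Unique (f i)) →
                            (∀ {i j y} → y ∈ f i → y ∈ f j → i ≡ j) → Unique (concatMap f (allFin k))
  Unique-concatMap-allFin {k} f unique owner =
    concat⁺ {xss = map f (allFin k)} (All.map⁺ (All.tabulate λ {i} _ → unique i))
            (AllPairs.map⁺ (AllPairs.map (λ i≢j {_} (y∈fi , y∈fj) → i≢j (owner y∈fi y∈fj)) (allFin⁺ k)))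

  length-concatMap-allFin : ∀ {k} (f : Fin k → List B) (p : Fin k → Bool) →
                            (∀ i → length (f i) ≡ (if p i then 1 else 0)) → length (concatMap f (allFin k)) ≡ count p
  length-concatMap-allFin {k} f p length-f = trans (length-concatMap f (allFin k)) (cong sum (map-cong length-f (allFin k)))

  ∈-concatMap-allFin⁻ : ∀ {k} (f : Fin k → List B) {y} → y ∈ concatMap f (allFin k) → ∃[ i ] y ∈ f i
  ∈-concatMap-allFin⁻ {k} f y∈ = satisfied (∈-concatMap⁻ f {xs = allFin k} y∈)

module _ {n : ℕ} (p : Fin n → Bool) where
  private
    tally : List (Fin n) → ℕ
    tally xs = sum (map (λ i → if p i then 1 else 0) xs)

    tally-≥1 : ∀ {x xs} → x ∈ xs → T (p x) → 1 ≤ tally xs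
    tally-≥1 {x} (here refl) px with p x
    ... | true = s≤s z≤n
    tally-≥1 {xs = y ∷ _} (there x∈) px = ≤-trans (tally-≥1 x∈ px) (m≤n+m _ (if p y then 1 else 0))

    tally-≥2 : ∀ {x y xs} → x ≢ y → x ∈ xs → y ∈ xs → T (p x) → T (p y) → 2 ≤ tally xs
    tally-≥2 x≢y (here refl) (here refl) _ _ = ⊥-elim (x≢y refl)
    tally-≥2 {x} x≢y (here refl) (there y∈) px py with p x
    ... | true = s≤s (tally-≥1 y∈ py)
    tally-≥2 {y = y} x≢y (there x∈) (here refl) px py with p y
    ... | true = s≤s (tally-≥1 x∈ px)
    tally-≥2 {xs = z ∷ _} x≢y (there x∈) (there y∈) px py =
      ≤-trans (tally-≥2 x≢y x∈ y∈ px py) (m≤n+m _ (if p z then 1 else 0))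

    tally-≤1 : ∀ {x xs} → Unique xs → (∀ {y} → y ∈ xs → T (p y) → y ≡ x) → tally xs ≤ 1
    tally-≤1 {xs = []} _ _ = z≤n
    tally-≤1 {x} {y ∷ xs} (y∉xs ∷ uniq) only with p y in py
    ... | false = tally-≤1 uniq (λ z∈ → only (there z∈))
    ... | true = s≤s (≤-reflexive (tally≡0 (All.tabulate λ z∈ pz →
                   All.lookup y∉xs z∈ (trans (only (here refl) (T-≡ .from py)) (sym (only (there z∈) pz))))))
      where
      tally≡0 : ∀ {zs} → All (λ z → ¬ T (p z)) zs → tally zs ≡ 0
      tally≡0 [] = refl
      tally≡0 {z ∷ _} (¬pz ∷ none) with p z
      ... | true = ⊥-elim (¬pz _)
      ... | false = tally≡0 none

    tally-≥1⇒∃ : ∀ {xs} → 1 ≤ tally xs → ∃[ x ] T (p x)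
    tally-≥1⇒∃ {x ∷ xs} h with p x in px
    ... | true = x , T-≡ .from px
    ... | false = tally-≥1⇒∃ {xs} h

  count≡1⇒unique : ∀ {x y} → count p ≡ 1 → T (p x) → T (p y) → x ≡ y
  count≡1⇒unique {x} {y} c≡1 px py with x ≟ y
  ... | yes x≡y = x≡y
  ... | no x≢y = contradiction (subst (2 ≤_) c≡1 (tally-≥2 x≢y (∈-allFin x) (∈-allFin y) px py)) λ { (s≤s ()) }

  count≡1⇒∃ : count p ≡ 1 → ∃[ x ] T (p x)
  count≡1⇒∃ c≡1 = tally-≥1⇒∃ {allFin n} (≤-reflexive (sym c≡1))

  count≢1⇒another : ∀ {x} → count p ≢ 1 → T (p x) → ∃[ y ] y ≢ x × T (p y)
  count≢1⇒another {x} c≢1 px with any? (λ y → ¬? (y ≟ x) ×-dec T? (p y))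
  ... | yes another = another
  ... | no none = ⊥-elim (c≢1 (≤-antisym (tally-≤1 (allFin⁺ n) only) (tally-≥1 (∈-allFin x) px)))
    where
    only : ∀ {y} → y ∈ allFin n → T (p y) → y ≡ x
    only {y} _ py with y ≟ x
    ... | yes y≡x = y≡x
    ... | no y≢x = ⊥-elim (none (y , y≢x , py))

does-<?-asym : ∀ {n} {x w : Fin n} → x ≢ w → does (x <? w) ≢ does (w <? x)
does-<?-asym {x = x} {w} x≢w with <-cmp x w
... | tri< x<w _ _ rewrite dec-true (x <? w) x<w | dec-false (w <? x) (Finₚ.<-asym x<w) = λ ()
... | tri≈ _ x≡w _ = ⊥-elim (x≢w x≡w)
... | tri> _ _ w<x rewrite dec-true (w <? x) w<x | dec-false (x <? w) (Finₚ.<-asym w<x) = λ ()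

⌈m+m+n/2⌉≡m+⌈n/2⌉ : ∀ m n → ⌈ m + m + n /2⌉ ≡ m + ⌈ n /2⌉
⌈m+m+n/2⌉≡m+⌈n/2⌉ zero n = refl
⌈m+m+n/2⌉≡m+⌈n/2⌉ (suc m) n rewrite +-suc m m = cong suc (⌈m+m+n/2⌉≡m+⌈n/2⌉ m n)

m+m+n≤k+k⇒m+⌈n/2⌉≤k : ∀ m n k → m + m + n ≤ k + k → m + ⌈ n /2⌉ ≤ k
m+m+n≤k+k⇒m+⌈n/2⌉≤k m n k bound = begin
  m + ⌈ n /2⌉     ≡⟨ ⌈m+m+n/2⌉≡m+⌈n/2⌉ m n ⟨
  ⌈ m + m + n /2⌉ ≤⟨ ⌈n/2⌉-mono bound ⟩
  ⌈ k + k /2⌉     ≡⟨ cong ⌈_/2⌉ (+-identityʳ (k + k)) ⟨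
  ⌈ k + k + 0 /2⌉ ≡⟨ ⌈m+m+n/2⌉≡m+⌈n/2⌉ k 0 ⟩
  k + 0           ≡⟨ +-identityʳ k ⟩
  k               ∎
  where open ≤-Reasoning

-- Trees and the leaves of T⁻

module GraphFacts {n : ℕ} (G : Graph n) where

  infix 4 _~_
  _~_ : Fin n → Fin n → Set
  u ~ v = Adj G u v

  _~?_ : ∀ u v → Dec (u ~ v)
  u ~? v = T? (adj G u v)

  ~-sym : ∀ {u v} → u ~ v → v ~ u
  ~-sym {u} {v} = subst T (Graph.sym G u v)

  ~-irrefl : ∀ {v} → ¬ v ~ v
  ~-irrefl {v} = subst T (irrefl G v)

  ~⇒≢ : ∀ {u v} → u ~ v → u ≢ v
  ~⇒≢ u~v refl = ~-irrefl u~v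

  Leaf : Fin n → Set
  Leaf v = T (isLeaf G v)

  leaf? : Decidable Leaf
  leaf? v = T? (isLeaf G v)

  Leaf⇒degree≡1 : ∀ {v} → Leaf v → degree G v ≡ 1
  Leaf⇒degree≡1 {v} with degree G v
  ... | 1 = λ _ → refl

  ¬Leaf⇒degree≢1 : ∀ {v} → ¬ Leaf v → degree G v ≢ 1
  ¬Leaf⇒degree≢1 {v} with degree G v
  ... | 1 = λ ¬leaf _ → ¬leaf _
  ... | 0 = λ _ ()
  ... | suc (suc _) = λ _ ()

  leaf-neighbour-unique : ∀ {z a b} → Leaf z → z ~ a → z ~ b → a ≡ b
  leaf-neighbour-unique leaf = count≡1⇒unique (adj G _) (Leaf⇒degree≡1 leaf)

  nonleaf-another-neighbour : ∀ {y x} → ¬ Leaf y → y ~ x → ∃[ w ] w ≢ x × y ~ w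
  nonleaf-another-neighbour ¬leaf = count≢1⇒another (adj G _) (¬Leaf⇒degree≢1 ¬leaf)

  connected-closed : Connected G → ∀ (Q : Pred (Fin n) 0ℓ) → (∀ {u v} → Q u → u ~ v → Q v) →
                     ∀ {a} → Q a → ∀ v → Q v
  connected-closed conn Q closed {a} qa v = along (conn a v) qa
    where
    along : ∀ {u v} → Walk G u v → Q u → Q v
    along nil qu = qu
    along (cons u~w walk) qu = along walk (closed qu u~w)

  leaves-nonadjacent : Connected G → ∀ {c} → ¬ Leaf c → ∀ {z t} → Leaf z → Leaf t → ¬ z ~ t
  leaves-nonadjacent conn {c} ¬leaf-c {z} {t} leaf-z leaf-t z~t
    with connected-closed conn (λ v → v ≡ z ⊎ v ≡ t) closed (inj₁ refl) c
    where
    closed : ∀ {u v} → u ≡ z ⊎ u ≡ t → u ~ v → v ≡ z ⊎ v ≡ t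
    closed (inj₁ refl) u~v = inj₂ (leaf-neighbour-unique leaf-z u~v z~t)
    closed (inj₂ refl) u~v = inj₁ (leaf-neighbour-unique leaf-t u~v (~-sym z~t))
  ... | inj₁ refl = ¬leaf-c leaf-z
  ... | inj₂ refl = ¬leaf-c leaf-t

  HasP3⇒nonleaf-edge : HasP3 G → ∃[ b ] ∃[ c ] b ~ c × ¬ Leaf b × ¬ Leaf c
  HasP3⇒nonleaf-edge (a , b , c , d , (_ ∷ a≢c ∷ _ ∷ []) ∷ (_ ∷ b≢d ∷ []) ∷ _ , a~b , b~c , c~d) =
    b , c , b~c , (λ leaf-b → a≢c (leaf-neighbour-unique leaf-b (~-sym a~b) b~c))
              , (λ leaf-c → b≢d (leaf-neighbour-unique leaf-c (~-sym b~c) c~d))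

  acyclic⇒triangle-free : ¬ HasCycle G → ∀ {x a b} → x ~ a → x ~ b → ¬ a ~ b
  acyclic⇒triangle-free acyclic {x} {a} {b} x~a x~b a~b =
    acyclic (x , a , [] , b , x,a,b-distinct , x~a ∷ a~b ∷ [-] , ~-sym x~b)
    where
    x,a,b-distinct : Unique (x ∷ a ∷ b ∷ [])
    x,a,b-distinct = (~⇒≢ x~a ∷ ~⇒≢ x~b ∷ []) ∷ (~⇒≢ a~b ∷ []) ∷ [] ∷ []

  InTminus⇔¬Leaf : ∀ {v} → T (inTminus G v) ⇔ (¬ Leaf v)
  InTminus⇔¬Leaf {v} with isLeaf G v
  ... | true = mk⇔ (λ ()) (λ ¬leaf → ¬leaf _)
  ... | false = mk⇔ (λ _ ()) _

  -- ell counts through a helper local to Defs; reading the predicate off ell itself makes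
  -- ell≡count-tminusLeaf hold by refl.
  private
    ell-as-count : Σ (Fin n → Bool) λ p → ell G ≡ count p
    ell-as-count = _ , refl

  tminusLeafᵇ : Fin n → Bool
  tminusLeafᵇ = proj₁ ell-as-count

  ell≡count-tminusLeaf : ell G ≡ count tminusLeafᵇ
  ell≡count-tminusLeaf = proj₂ ell-as-count

  TminusLeaf : Fin n → Set
  TminusLeaf x = T (tminusLeafᵇ x)

  TminusLeaf⇒¬Leaf : ∀ {x} → TminusLeaf x → ¬ Leaf x
  TminusLeaf⇒¬Leaf tl = InTminus⇔¬Leaf .to (proj₁ (T-∧ .to tl))

  TminusLeaf⇒degreeTminus≡1 : ∀ {x} → TminusLeaf x → degreeTminus G x ≡ 1
  TminusLeaf⇒degreeTminus≡1 {x} with inTminus G x | degreeTminus G x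
  ... | true | 1 = λ _ → refl

  module _ {x} (tminus-x : TminusLeaf x) where

    tminus-neighbour-unique : ∀ {a b} → x ~ a → ¬ Leaf a → x ~ b → ¬ Leaf b → a ≡ b
    tminus-neighbour-unique x~a ¬leaf-a x~b ¬leaf-b =
      count≡1⇒unique (λ u → adj G x u ∧ inTminus G u) (TminusLeaf⇒degreeTminus≡1 tminus-x)
        (T-∧ .from (x~a , InTminus⇔¬Leaf .from ¬leaf-a)) (T-∧ .from (x~b , InTminus⇔¬Leaf .from ¬leaf-b))

    tminus-parent : ∃[ y ] x ~ y × ¬ Leaf y
    tminus-parent with count≡1⇒∃ (λ u → adj G x u ∧ inTminus G u) (TminusLeaf⇒degreeTminus≡1 tminus-x)
    ... | y , x~y∧y∈Tminus with T-∧ .to x~y∧y∈Tminus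
    ...   | x~y , y∈Tminus = y , x~y , InTminus⇔¬Leaf .to y∈Tminus

    tminus-neighbour-parent-or-leaf : ∀ {y w} → x ~ y → ¬ Leaf y → x ~ w → w ≡ y ⊎ Leaf w
    tminus-neighbour-parent-or-leaf {w = w} x~y ¬leaf-y x~w with leaf? w
    ... | yes leaf-w = inj₂ leaf-w
    ... | no ¬leaf-w = inj₁ (tminus-neighbour-unique x~w ¬leaf-w x~y ¬leaf-y)

    tminus-leaf-child : ∀ {y} → x ~ y → ¬ Leaf y → ∃[ z ] x ~ z × Leaf z
    tminus-leaf-child x~y ¬leaf-y with nonleaf-another-neighbour (TminusLeaf⇒¬Leaf tminus-x) x~y
    ... | w , w≢y , x~w with tminus-neighbour-parent-or-leaf x~y ¬leaf-y x~w
    ...   | inj₁ w≡y = ⊥-elim (w≢y w≡y)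
    ...   | inj₂ leaf-w = w , x~w , leaf-w

  adjacent-TminusLeaves-cover : Connected G → ∀ {x w} → TminusLeaf x → TminusLeaf w → x ~ w →
                                ∀ v → v ≡ x ⊎ v ≡ w ⊎ Leaf v
  adjacent-TminusLeaves-cover conn {x} {w} tminus-x tminus-w x~w v
    with connected-closed conn Near closed (inj₁ refl) v
    where
    Near : Pred (Fin n) 0ℓ
    Near c = c ≡ x ⊎ c ≡ w ⊎ (Leaf c × (x ~ c ⊎ w ~ c))
    closed : ∀ {u c} → Near u → u ~ c → Near c
    closed (inj₁ refl) x~c with tminus-neighbour-parent-or-leaf tminus-x x~w (TminusLeaf⇒¬Leaf tminus-w) x~c
    ... | inj₁ c≡w = inj₂ (inj₁ c≡w)
    ... | inj₂ leaf = inj₂ (inj₂ (leaf , inj₁ x~c))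
    closed (inj₂ (inj₁ refl)) w~c with tminus-neighbour-parent-or-leaf tminus-w (~-sym x~w) (TminusLeaf⇒¬Leaf tminus-x) w~c
    ... | inj₁ c≡x = inj₁ c≡x
    ... | inj₂ leaf = inj₂ (inj₂ (leaf , inj₂ w~c))
    closed (inj₂ (inj₂ (leaf , inj₁ x~u))) u~c with leaf-neighbour-unique leaf (~-sym x~u) u~c
    ... | refl = inj₁ refl
    closed (inj₂ (inj₂ (leaf , inj₂ w~u))) u~c with leaf-neighbour-unique leaf (~-sym w~u) u~c
    ... | refl = inj₂ (inj₁ refl)
  ... | inj₁ v≡x = inj₁ v≡x
  ... | inj₂ (inj₁ v≡w) = inj₂ (inj₁ v≡w)
  ... | inj₂ (inj₂ (leaf , _)) = inj₂ (inj₂ leaf)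

-- Hyperarcs, closures and representations

SamePair : ∀ {n} → Fin n → Fin n → Fin n → Fin n → Set
SamePair a b u v = (a ≡ u × b ≡ v) ⊎ (a ≡ v × b ≡ u)

SamePair-swapˡ : ∀ {n} {a b u v : Fin n} → SamePair a b u v → SamePair b a u v
SamePair-swapˡ (inj₁ (a≡u , b≡v)) = inj₂ (b≡v , a≡u)
SamePair-swapˡ (inj₂ (a≡v , b≡u)) = inj₁ (b≡u , a≡v)

SamePair-swapʳ : ∀ {n} {a b u v : Fin n} → SamePair a b u v → SamePair a b v u
SamePair-swapʳ (inj₁ (a≡u , b≡v)) = inj₂ (a≡u , b≡v)
SamePair-swapʳ (inj₂ (a≡v , b≡u)) = inj₁ (a≡v , b≡u)

SamePair? : ∀ {n} (a b u v : Fin n) → Dec (SamePair a b u v)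
SamePair? a b u v = (a ≟ u ×-dec b ≟ v) ⊎-dec (a ≟ v ×-dec b ≟ u)

SamePair-ordered : ∀ {n} {a b u v u′ v′ : Fin n} → SamePair a b u v → SamePair a b u′ v′ →
                   toℕ u < toℕ v → toℕ u′ < toℕ v′ → u ≡ u′ × v ≡ v′
SamePair-ordered (inj₁ (refl , refl)) (inj₁ (refl , refl)) _ _ = refl , refl
SamePair-ordered (inj₂ (refl , refl)) (inj₂ (refl , refl)) _ _ = refl , refl
SamePair-ordered (inj₁ (refl , refl)) (inj₂ (refl , refl)) u<v u′<v′ = ⊥-elim (<-asym u<v u′<v′)
SamePair-ordered (inj₂ (refl , refl)) (inj₁ (refl , refl)) u<v u′<v′ = ⊥-elim (<-asym u<v u′<v′)

BodyIs : ∀ {n} → Hyperarc n → Fin n → Fin n → Set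
BodyIs e u v = SamePair (tail₁ e) (tail₂ e) u v

InBody : ∀ {n} → Hyperarc n → Fin n → Set
InBody e x = tail₁ e ≡ x ⊎ tail₂ e ≡ x

BodyIs⇒InBodyˡ : ∀ {n} {e : Hyperarc n} {u v} → BodyIs e u v → InBody e u
BodyIs⇒InBodyˡ (inj₁ (tail₁≡u , _)) = inj₁ tail₁≡u
BodyIs⇒InBodyˡ (inj₂ (_ , tail₂≡u)) = inj₂ tail₂≡u

BodyIs⇒InBodyʳ : ∀ {n} {e : Hyperarc n} {u v} → BodyIs e u v → InBody e v
BodyIs⇒InBodyʳ (inj₁ (_ , tail₂≡v)) = inj₂ tail₂≡v
BodyIs⇒InBodyʳ (inj₂ (tail₁≡v , _)) = inj₁ tail₁≡v

BodyIs-unique : ∀ {n} {e : Hyperarc n} {u v x w} → BodyIs e u v → BodyIs e x w → SamePair u v x w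
BodyIs-unique (inj₁ (refl , refl)) body′ = body′
BodyIs-unique (inj₂ (refl , refl)) body′ = SamePair-swapˡ body′

module Closure {n : ℕ} (H : Hypergraph n) where

  record Exit (M : Pred (Fin n) 0ℓ) : Set where
    field
      arc    : Hyperarc n
      arc∈H  : arc ∈ H
      tail₁∈ : M (tail₁ arc)
      tail₂∈ : M (tail₂ arc)
      head∉  : ¬ M (head arc)

  closure-exit : ∀ {M S w} → Decidable M → (∀ {x} → S x → M x) → InClosure H S w → ¬ M w → Exit M
  closure-exit M? S⊆M (base s) w∉M = ⊥-elim (w∉M (S⊆M s))
  closure-exit M? S⊆M (step e e∈H cl₁ cl₂) head∉M with M? (tail₁ e) | M? (tail₂ e)
  ... | no tail₁∉M | _ = closure-exit M? S⊆M cl₁ tail₁∉M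
  ... | yes _ | no tail₂∉M = closure-exit M? S⊆M cl₂ tail₂∉M
  ... | yes tail₁∈M | yes tail₂∈M = record { arc = e ; arc∈H = e∈H ; tail₁∈ = tail₁∈M ; tail₂∈ = tail₂∈M ; head∉ = head∉M }

module Representation {n : ℕ} {G : Graph n} {H : Hypergraph n} (rep : Represents H G) where
  open GraphFacts G
  open Closure H public

  arc-body-adjacent : ∀ {e} → e ∈ H → head e ≢ tail₁ e → head e ≢ tail₂ e → tail₁ e ~ tail₂ e
  arc-body-adjacent {e} e∈H head≢tail₁ head≢tail₂ with tail₁ e ~? tail₂ e
  ... | yes adjacent = adjacent
  ... | no ¬adjacent
    with proj₂ (rep (tail₁ e) (tail₂ e) (distinct e)) ¬adjacent (head e) (step e e∈H (base (inj₁ refl)) (base (inj₂ refl)))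
  ...   | inj₁ head≡tail₁ = ⊥-elim (head≢tail₁ head≡tail₁)
  ...   | inj₂ head≡tail₂ = ⊥-elim (head≢tail₂ head≡tail₂)

  module _ {M : Pred (Fin n) 0ℓ} where

    exit-body-adjacent : (E : Exit M) → tail₁ (Exit.arc E) ~ tail₂ (Exit.arc E)
    exit-body-adjacent E = arc-body-adjacent arc∈H (λ { refl → head∉ tail₁∈ }) (λ { refl → head∉ tail₂∈ })
      where open Exit E

    exit-from-edge : Decidable M → ∀ {u v w} → u ~ v → M u → M v → ¬ M w → Exit M
    exit-from-edge M? {u} {v} {w} u~v u∈M v∈M w∉M =
      closure-exit M? (λ { (inj₁ refl) → u∈M ; (inj₂ refl) → v∈M }) (proj₁ (rep u v (~⇒≢ u~v)) u~v w) w∉M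

    exit-through : ∀ {x} (E : Exit M) → InBody (Exit.arc E) x →
                   ∃[ t ] x ~ t × M t × BodyIs (Exit.arc E) x t
    exit-through E (inj₁ refl) = _ , exit-body-adjacent E , Exit.tail₂∈ E , inj₁ (refl , refl)
    exit-through E (inj₂ refl) = _ , ~-sym (exit-body-adjacent E) , Exit.tail₁∈ E , inj₂ (refl , refl)

    exit-body : ∀ {u v} → (∀ {a b} → M a → M b → a ~ b → SamePair a b u v) → (E : Exit M) → BodyIs (Exit.arc E) u v
    exit-body only-edge E = only-edge (Exit.tail₁∈ E) (Exit.tail₂∈ E) (exit-body-adjacent E)

-- Charging slots of hyperarcs to edges and to leaves of T⁻

module Charging {n : ℕ} {G : Graph n} (conn : Connected G) (acyclic : ¬ HasCycle G)
                {b c : Fin n} (b~c : Adj G b c) (¬leaf-b : ¬ GraphFacts.Leaf G b) (¬leaf-c : ¬ GraphFacts.Leaf G c)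
                {H : Hypergraph n} (rep : Represents H G) where
  open GraphFacts G
  open Representation {G = G} {H = H} rep

  Far : Fin n → Fin n → Pred (Fin n) 0ℓ
  Far u v h = Leaf h × ¬ h ~ u × ¬ h ~ v

  Excluded : Fin n → Fin n → Pred (Fin n) 0ℓ
  Excluded u v h = h ≡ u ⊎ h ≡ v ⊎ Far u v h

  Excluded? : ∀ u v → Decidable (Excluded u v)
  Excluded? u v h = h ≟ u ⊎-dec h ≟ v ⊎-dec leaf? h ×-dec ¬? (h ~? u) ×-dec ¬? (h ~? v)

  Excluded-swap : ∀ {u v h} → Excluded u v h → Excluded v u h
  Excluded-swap (inj₁ h≡u) = inj₂ (inj₁ h≡u)
  Excluded-swap (inj₂ (inj₁ h≡v)) = inj₁ h≡v
  Excluded-swap (inj₂ (inj₂ (leaf , ¬h~u , ¬h~v))) = inj₂ (inj₂ (leaf , ¬h~v , ¬h~u))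

  ¬Excluded : ∀ {u v h} → h ≢ u → h ≢ v → ¬ Leaf h ⊎ h ~ u ⊎ h ~ v → ¬ Excluded u v h
  ¬Excluded h≢u _ _ (inj₁ h≡u) = h≢u h≡u
  ¬Excluded _ h≢v _ (inj₂ (inj₁ h≡v)) = h≢v h≡v
  ¬Excluded _ _ (inj₁ ¬leaf) (inj₂ (inj₂ (leaf , _))) = ¬leaf leaf
  ¬Excluded _ _ (inj₂ (inj₁ h~u)) (inj₂ (inj₂ (_ , ¬h~u , _))) = ¬h~u h~u
  ¬Excluded _ _ (inj₂ (inj₂ h~v)) (inj₂ (inj₂ (_ , _ , ¬h~v))) = ¬h~v h~v

  excluded-misses-some : ∀ u v → ∃[ o ] ¬ Excluded u v o
  excluded-misses-some u v with nonleaf-another-neighbour ¬leaf-b b~c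
  ... | a , a≢c , b~a with b ≟ u | b ≟ v | c ≟ u | c ≟ v
  ...   | no b≢u | no b≢v | _ | _ = b , ¬Excluded b≢u b≢v (inj₁ ¬leaf-b)
  ...   | _ | _ | no c≢u | no c≢v = c , ¬Excluded c≢u c≢v (inj₁ ¬leaf-c)
  ...   | yes refl | _ | _ | yes refl = a , ¬Excluded (~⇒≢ (~-sym b~a)) a≢c (inj₂ (inj₁ (~-sym b~a)))
  ...   | _ | yes refl | yes refl | _ = a , ¬Excluded a≢c (~⇒≢ (~-sym b~a)) (inj₂ (inj₂ (~-sym b~a)))
  ...   | yes refl | _ | yes refl | _ = ⊥-elim (~⇒≢ b~c refl)
  ...   | _ | yes refl | _ | yes refl = ⊥-elim (~⇒≢ b~c refl)

  excluded-only-edge : ∀ {u v a b} → Excluded u v a → Excluded u v b → a ~ b → SamePair a b u v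
  excluded-only-edge (inj₁ refl) (inj₂ (inj₁ refl)) _ = inj₁ (refl , refl)
  excluded-only-edge (inj₂ (inj₁ refl)) (inj₁ refl) _ = inj₂ (refl , refl)
  excluded-only-edge (inj₁ refl) (inj₁ refl) a~b = ⊥-elim (~-irrefl a~b)
  excluded-only-edge (inj₂ (inj₁ refl)) (inj₂ (inj₁ refl)) a~b = ⊥-elim (~-irrefl a~b)
  excluded-only-edge (inj₁ refl) (inj₂ (inj₂ (_ , ¬b~u , _))) a~b = ⊥-elim (¬b~u (~-sym a~b))
  excluded-only-edge (inj₂ (inj₁ refl)) (inj₂ (inj₂ (_ , _ , ¬b~v))) a~b = ⊥-elim (¬b~v (~-sym a~b))
  excluded-only-edge (inj₂ (inj₂ (_ , ¬a~u , _))) (inj₁ refl) a~b = ⊥-elim (¬a~u a~b)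
  excluded-only-edge (inj₂ (inj₂ (_ , _ , ¬a~v))) (inj₂ (inj₁ refl)) a~b = ⊥-elim (¬a~v a~b)
  excluded-only-edge (inj₂ (inj₂ (leaf-a , _))) (inj₂ (inj₂ (leaf-b , _))) a~b =
    ⊥-elim (leaves-nonadjacent conn ¬leaf-b leaf-a leaf-b a~b)

  EdgeArc : Fin n → Fin n → Pred (Hyperarc n) 0ℓ
  EdgeArc u v e = BodyIs e u v × ¬ Excluded u v (head e)

  EdgeArc? : ∀ u v → Decidable (EdgeArc u v)
  EdgeArc? u v e = SamePair? (tail₁ e) (tail₂ e) u v ×-dec ¬? (Excluded? u v (head e))

  EdgeArc-swap : ∀ u v {e} → EdgeArc u v e → EdgeArc v u e
  EdgeArc-swap u v (body , head∉) = SamePair-swapʳ body , λ excluded → head∉ (Excluded-swap excluded)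

  edge-arc-exists : ∀ {u v} → u ~ v → ∃[ e ] e ∈ H × EdgeArc u v e
  edge-arc-exists {u} {v} u~v with excluded-misses-some u v
  ... | o , o∉ = Exit.arc E , Exit.arc∈H E , exit-body (excluded-only-edge {u} {v}) E , Exit.head∉ E
    where
    E : Exit (Excluded u v)
    E = exit-from-edge (Excluded? u v) u~v (inj₁ refl) (inj₂ (inj₁ refl)) o∉

  chosen : Fin n → Fin n → Maybe (Hyperarc n)
  chosen u v = find (EdgeArc? u v) H

  chosen-swap : ∀ u v → chosen u v ≡ chosen v u
  chosen-swap u v = find-cong (EdgeArc? u v) (EdgeArc? v u) (λ {e} → EdgeArc-swap u v {e}) (λ {e} → EdgeArc-swap v u {e}) H

  chosen-defined : ∀ {u v} → u ~ v → ∃[ e ] chosen u v ≡ just e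
  chosen-defined u~v with edge-arc-exists u~v
  ... | e , e∈H , edge-arc = find-complete (EdgeArc? _ _) e∈H edge-arc

  chosen-sound : ∀ {u v e} → chosen u v ≡ just e → e ∈ H × EdgeArc u v e
  chosen-sound = find-just (EdgeArc? _ _)

  Slot : Set
  Slot = Hyperarc n × Bool

  isEdgeᵇ : Fin n → Fin n → Bool
  isEdgeᵇ u v = (toℕ u <ᵇ toℕ v) ∧ adj G u v

  record EdgeCharge (u v : Fin n) (e : Hyperarc n) : Set where
    constructor edgeCharge
    field
      ordered : toℕ u < toℕ v
      chosen≡ : chosen u v ≡ just e

  edgeSlotsAt : Bool → Fin n → Fin n → List Slot
  edgeSlotsAt s u v = if isEdgeᵇ u v then map (_, s) (fromMaybe (chosen u v)) else []

  length-edgeSlotsAt : ∀ s u v → length (edgeSlotsAt s u v) ≡ (if isEdgeᵇ u v then 1 else 0)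
  length-edgeSlotsAt s u v with isEdgeᵇ u v in uv-edge
  ... | false = refl
  ... | true with chosen u v in chosen≡
  ...   | just _ = refl
  ...   | nothing = contradiction (trans (sym chosen≡) (proj₂ (chosen-defined (proj₂ (T-∧ .to (T-≡ .from uv-edge)))))) λ ()

  ∈-edgeSlotsAt : ∀ {s} u v {t} → t ∈ edgeSlotsAt s u v → EdgeCharge u v (proj₁ t) × proj₂ t ≡ s
  ∈-edgeSlotsAt u v t∈ with isEdgeᵇ u v in uv-edge | chosen u v in chosen≡
  ∈-edgeSlotsAt u v () | false | _
  ∈-edgeSlotsAt u v () | true | nothing
  ∈-edgeSlotsAt u v (here refl) | true | just e = edgeCharge (<ᵇ⇒< _ _ (proj₁ (T-∧ .to (T-≡ .from uv-edge)))) chosen≡ , refl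

  Unique-edgeSlotsAt : ∀ s u v → Unique (edgeSlotsAt s u v)
  Unique-edgeSlotsAt s u v with isEdgeᵇ u v | chosen u v
  ... | false | _ = []
  ... | true | nothing = []
  ... | true | just _ = [] ∷ []

  EdgeCharge-injective : ∀ {u v u′ v′ e} → EdgeCharge u v e → EdgeCharge u′ v′ e → u ≡ u′ × v ≡ v′
  EdgeCharge-injective (edgeCharge u<v chosen≡) (edgeCharge u′<v′ chosen′≡) =
    SamePair-ordered (proj₁ (proj₂ (chosen-sound chosen≡))) (proj₁ (proj₂ (chosen-sound chosen′≡))) u<v u′<v′

  AvoidsChosen : Fin n → Fin n → Hyperarc n → Set
  AvoidsChosen x w e = ∀ {r} → chosen x w ≡ just r → head r ≢ head e

  -- The bit is false only when w is a leaf of T⁻ as well; it then tells the side charges of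
  -- x and w apart, and T⁻ = {x, w} leaves no room for a hanging-leaf charge on the same arc.
  sideBit : Fin n → Fin n → Bool
  sideBit x w = if tminusLeafᵇ w then does (x <? w) else true

  LeafCharge : Fin n → Pred Slot 0ℓ
  LeafCharge x (e , s) = s ≡ false × x ~ head e × Leaf (head e) × ¬ InBody e x

  record SideCharge (x : Fin n) (t : Slot) : Set where
    field
      partner   : Fin n
      x~partner : x ~ partner
      body      : BodyIs (proj₁ t) x partner
      avoids    : AvoidsChosen x partner (proj₁ t)
      bit≡      : proj₂ t ≡ sideBit x partner

  TminusCharge : Fin n → Pred Slot 0ℓ
  TminusCharge x t = proj₁ t ∈ H × (LeafCharge x t ⊎ SideCharge x t)

  record TwoArcs (x w : Fin n) : Set where
    field
      arc₁ arc₂    : Hyperarc n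
      arc₁∈H       : arc₁ ∈ H
      arc₂∈H       : arc₂ ∈ H
      body₁        : BodyIs arc₁ x w
      body₂        : BodyIs arc₂ x w
      heads-differ : head arc₁ ≢ head arc₂

  two-arcs⇒avoiding : ∀ {x w} → TwoArcs x w → ∃[ e ] e ∈ H × BodyIs e x w × AvoidsChosen x w e
  two-arcs⇒avoiding {x} {w} two = avoid (chosen x w)
    where
    open TwoArcs two
    avoid : ∀ m → ∃[ e ] e ∈ H × BodyIs e x w × (∀ {r} → m ≡ just r → head r ≢ head e)
    avoid nothing = arc₁ , arc₁∈H , body₁ , λ ()
    avoid (just r) with head r ≟ head arc₁
    ... | yes r≡₁ = arc₂ , arc₂∈H , body₂ , λ { refl r≡₂ → heads-differ (trans (sym r≡₁) r≡₂) }
    ... | no r≢₁ = arc₁ , arc₁∈H , body₁ , λ { refl → r≢₁ }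

  side-charge : ∀ {x} → (∃[ w ] x ~ w × TwoArcs x w) → ∃ (TminusCharge x)
  side-charge {x} (w , x~w , two) with two-arcs⇒avoiding two
  ... | e , e∈H , body , avoids =
    (e , sideBit x w) , e∈H , inj₂ (record { partner = w ; x~partner = x~w ; body = body ; avoids = avoids ; bit≡ = refl })

  two-arcs-to-leaf : ∀ {x o y g} → x ~ o → Leaf o → x ~ y → ¬ Leaf y →
                     g ∈ H → BodyIs g x o → head g ≢ x → ¬ x ~ head g → TwoArcs x o
  two-arcs-to-leaf {x} {o} {y} {g} x~o leaf-o x~y ¬leaf-y g∈H body-g head≢x ¬x~head = record
    { arc₁ = g ; arc₂ = Exit.arc E ; arc₁∈H = g∈H ; arc₂∈H = Exit.arc∈H E
    ; body₁ = body-g ; body₂ = exit-body only-edge E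
    ; heads-differ = λ heads≡ → Exit.head∉ E (inj₂ (inj₂ (sym heads≡))) }
    where
    M : Pred (Fin n) 0ℓ
    M h = h ≡ x ⊎ h ≡ o ⊎ h ≡ head g
    o~head⇒⊥ : ¬ o ~ head g
    o~head⇒⊥ o~head = head≢x (leaf-neighbour-unique leaf-o o~head (~-sym x~o))
    only-edge : ∀ {a b} → M a → M b → a ~ b → SamePair a b x o
    only-edge (inj₁ refl) (inj₂ (inj₁ refl)) _ = inj₁ (refl , refl)
    only-edge (inj₂ (inj₁ refl)) (inj₁ refl) _ = inj₂ (refl , refl)
    only-edge (inj₁ refl) (inj₁ refl) a~b = ⊥-elim (~-irrefl a~b)
    only-edge (inj₂ (inj₁ refl)) (inj₂ (inj₁ refl)) a~b = ⊥-elim (~-irrefl a~b)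
    only-edge (inj₂ (inj₂ refl)) (inj₂ (inj₂ refl)) a~b = ⊥-elim (~-irrefl a~b)
    only-edge (inj₁ refl) (inj₂ (inj₂ refl)) a~b = ⊥-elim (¬x~head a~b)
    only-edge (inj₂ (inj₂ refl)) (inj₁ refl) a~b = ⊥-elim (¬x~head (~-sym a~b))
    only-edge (inj₂ (inj₁ refl)) (inj₂ (inj₂ refl)) a~b = ⊥-elim (o~head⇒⊥ a~b)
    only-edge (inj₂ (inj₂ refl)) (inj₂ (inj₁ refl)) a~b = ⊥-elim (o~head⇒⊥ (~-sym a~b))
    y∉M : ¬ M y
    y∉M (inj₁ refl) = ~-irrefl x~y
    y∉M (inj₂ (inj₁ refl)) = ¬leaf-y leaf-o
    y∉M (inj₂ (inj₂ refl)) = ¬x~head x~y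
    E : Exit M
    E = exit-from-edge (λ h → h ≟ x ⊎-dec h ≟ o ⊎-dec h ≟ head g) x~o (inj₁ refl) (inj₂ (inj₁ refl)) y∉M

  ClosedNbhd : Fin n → Pred (Fin n) 0ℓ
  ClosedNbhd x h = h ≡ x ⊎ x ~ h

  closed-nbhd-exit : ∀ {x y} → x ~ y → ¬ Leaf y → Exit (ClosedNbhd x)
  closed-nbhd-exit {x} x~y ¬leaf-y with nonleaf-another-neighbour ¬leaf-y (~-sym x~y)
  ... | w , w≢x , y~w = exit-from-edge (λ h → h ≟ x ⊎-dec x ~? h) x~y (inj₁ refl) (inj₂ x~y) w∉N[x]
    where
    w∉N[x] : ¬ ClosedNbhd x w
    w∉N[x] (inj₁ w≡x) = w≢x w≡x
    w∉N[x] (inj₂ x~w) = acyclic⇒triangle-free acyclic x~y x~w y~w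

  closed-nbhd-exit-body : ∀ {x} (E : Exit (ClosedNbhd x)) → ∃[ o ] x ~ o × BodyIs (Exit.arc E) x o
  closed-nbhd-exit-body E with Exit.tail₁∈ E | Exit.tail₂∈ E
  ... | inj₁ tail₁≡x | _ = let o , x~o , _ , body = exit-through E (inj₁ tail₁≡x) in o , x~o , body
  ... | inj₂ _ | inj₁ tail₂≡x = let o , x~o , _ , body = exit-through E (inj₂ tail₂≡x) in o , x~o , body
  ... | inj₂ x~tail₁ | inj₂ x~tail₂ = ⊥-elim (acyclic⇒triangle-free acyclic x~tail₁ x~tail₂ (exit-body-adjacent E))

  two-arcs-near-parent : ∀ {x y g} → TminusLeaf x → x ~ y → ¬ Leaf y → g ∈ H → BodyIs g x y → x ~ head g →
                         ∃[ w ] x ~ w × TwoArcs x w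
  two-arcs-near-parent {x} {y} {g} tminus-x x~y ¬leaf-y g∈H body-g x~head = from-exit (closed-nbhd-exit x~y ¬leaf-y)
    where
    from-exit : Exit (ClosedNbhd x) → ∃[ w ] x ~ w × TwoArcs x w
    from-exit E with closed-nbhd-exit-body E
    ... | o , x~o , body-o with leaf? o
    ...   | yes leaf-o = o , x~o , two-arcs-to-leaf x~o leaf-o x~y ¬leaf-y (Exit.arc∈H E) body-o
                                     (λ head≡x → Exit.head∉ E (inj₁ head≡x)) (λ x~head′ → Exit.head∉ E (inj₂ x~head′))
    ...   | no ¬leaf-o = y , x~y , record
      { arc₁ = g ; arc₂ = Exit.arc E ; arc₁∈H = g∈H ; arc₂∈H = Exit.arc∈H E
      ; body₁ = body-g ; body₂ = subst (BodyIs (Exit.arc E) x) (tminus-neighbour-unique tminus-x x~o ¬leaf-o x~y ¬leaf-y) body-o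
      ; heads-differ = λ heads≡ → Exit.head∉ E (inj₂ (subst (x ~_) heads≡ x~head)) }

  NotHangingAt : Fin n → Pred (Fin n) 0ℓ
  NotHangingAt x h = ¬ (Leaf h × x ~ h)

  hanging-exit : ∀ {x y} → TminusLeaf x → x ~ y → ¬ Leaf y → Exit (NotHangingAt x)
  hanging-exit {x} tminus-x x~y ¬leaf-y with tminus-leaf-child tminus-x x~y ¬leaf-y
  ... | z , x~z , leaf-z = exit-from-edge (λ h → ¬? (leaf? h ×-dec x ~? h)) x~y
    (λ (leaf-x , _) → TminusLeaf⇒¬Leaf tminus-x leaf-x) (λ (leaf-y , _) → ¬leaf-y leaf-y) (λ z∈M → z∈M (leaf-z , x~z))

  exit-head-hanging : ∀ {x} (E : Exit (NotHangingAt x)) → Leaf (head (Exit.arc E)) × x ~ head (Exit.arc E)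
  exit-head-hanging {x} E = decidable-stable (leaf? _ ×-dec x ~? _) (Exit.head∉ E)

  tminus-charge : ∀ {x} → TminusLeaf x → ∃ (TminusCharge x)
  tminus-charge {x} tminus-x with tminus-parent tminus-x
  ... | y , x~y , ¬leaf-y = charge (hanging-exit tminus-x x~y ¬leaf-y)
    where
    charge : Exit (NotHangingAt x) → ∃ (TminusCharge x)
    charge E with tail₁ (Exit.arc E) ≟ x ⊎-dec tail₂ (Exit.arc E) ≟ x
    ... | no x∉body = (Exit.arc E , false) , Exit.arc∈H E ,
                      inj₁ (refl , proj₂ (exit-head-hanging E) , proj₁ (exit-head-hanging E) , x∉body)
    ... | yes x∈body =
      let t , x~t , t∈M , body = exit-through E x∈body
          t≡y = tminus-neighbour-unique tminus-x x~t (λ leaf-t → t∈M (leaf-t , x~t)) x~y ¬leaf-y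
      in side-charge (two-arcs-near-parent tminus-x x~y ¬leaf-y (Exit.arc∈H E)
                        (subst (BodyIs (Exit.arc E) x) t≡y body) (proj₂ (exit-head-hanging E)))

  sideBit-TminusLeaf : ∀ {x w} → TminusLeaf w → sideBit x w ≡ does (x <? w)
  sideBit-TminusLeaf {w = w} tminus-w with tminusLeafᵇ w
  ... | true = refl

  sideBit≡false⇒TminusLeaf : ∀ {x w} → sideBit x w ≡ false → TminusLeaf w
  sideBit≡false⇒TminusLeaf {w = w} with tminusLeafᵇ w
  ... | true = λ _ → _
  ... | false = λ ()

  EdgeCharge-LeafCharge-disjoint : ∀ {u v x t} → EdgeCharge u v (proj₁ t) → ¬ LeafCharge x t
  EdgeCharge-LeafCharge-disjoint {u} {v} {t = e , _} (edgeCharge _ chosen≡) (_ , x~h , leaf-h , x∉body)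
    with chosen-sound chosen≡
  ... | _ , body , h∉excluded with head e ~? u | head e ~? v
  ...   | yes h~u | _ = x∉body (subst (InBody e) (leaf-neighbour-unique leaf-h h~u (~-sym x~h)) (BodyIs⇒InBodyˡ {e = e} body))
  ...   | _ | yes h~v = x∉body (subst (InBody e) (leaf-neighbour-unique leaf-h h~v (~-sym x~h)) (BodyIs⇒InBodyʳ {e = e} body))
  ...   | no ¬h~u | no ¬h~v = h∉excluded (inj₂ (inj₂ (leaf-h , ¬h~u , ¬h~v)))

  EdgeCharge-SideCharge-disjoint : ∀ {u v x t} → EdgeCharge u v (proj₁ t) → ¬ SideCharge x t
  EdgeCharge-SideCharge-disjoint {u} {v} {t = e , _} (edgeCharge _ chosen≡) side with BodyIs-unique {e = e} (proj₁ (proj₂ (chosen-sound chosen≡))) (SideCharge.body side)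
  ... | inj₁ (refl , refl) = SideCharge.avoids side chosen≡ refl
  ... | inj₂ (refl , refl) = SideCharge.avoids side (trans (chosen-swap v u) chosen≡) refl

  EdgeCharge-TminusCharge-disjoint : ∀ {u v x t} → EdgeCharge u v (proj₁ t) → ¬ (LeafCharge x t ⊎ SideCharge x t)
  EdgeCharge-TminusCharge-disjoint edge (inj₁ leaf) = EdgeCharge-LeafCharge-disjoint edge leaf
  EdgeCharge-TminusCharge-disjoint edge (inj₂ side) = EdgeCharge-SideCharge-disjoint edge side

  LeafCharge-SideCharge-disjoint : ∀ {x x′ t} → TminusLeaf x → TminusLeaf x′ → LeafCharge x t → ¬ SideCharge x′ t
  LeafCharge-SideCharge-disjoint {x} {t = e , _} tminus-x tminus-x′ (s≡false , _ , _ , x∉body) side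
    with adjacent-TminusLeaves-cover conn tminus-x′ (sideBit≡false⇒TminusLeaf (trans (sym bit≡) s≡false)) x~partner x
    where open SideCharge side
  ... | inj₁ refl = x∉body (BodyIs⇒InBodyˡ {e = e} (SideCharge.body side))
  ... | inj₂ (inj₁ refl) = x∉body (BodyIs⇒InBodyʳ {e = e} (SideCharge.body side))
  ... | inj₂ (inj₂ leaf-x) = TminusLeaf⇒¬Leaf tminus-x leaf-x

  SideCharges-disjoint : ∀ {x x′ t} → x ≢ x′ → TminusLeaf x → TminusLeaf x′ → SideCharge x t → ¬ SideCharge x′ t
  SideCharges-disjoint {x} {x′} {t} x≢x′ tminus-x tminus-x′ side side′
    with BodyIs-unique {e = proj₁ t} (SideCharge.body side) (SideCharge.body side′)
  ... | inj₁ (x≡x′ , _) = x≢x′ x≡x′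
  ... | inj₂ (refl , refl) =
    does-<?-asym x≢x′ (begin
      does (x <? x′)  ≡⟨ sideBit-TminusLeaf tminus-x′ ⟨
      sideBit x x′    ≡⟨ SideCharge.bit≡ side ⟨
      proj₂ t         ≡⟨ SideCharge.bit≡ side′ ⟩
      sideBit x′ x    ≡⟨ sideBit-TminusLeaf tminus-x ⟩
      does (x′ <? x)  ∎)
    where open ≡-Reasoning

  TminusCharge-injective : ∀ {x x′ t} → TminusLeaf x → TminusLeaf x′ → TminusCharge x t → TminusCharge x′ t → x ≡ x′
  TminusCharge-injective {x} {x′} tminus-x tminus-x′ (_ , charge) (_ , charge′) with x ≟ x′
  ... | yes x≡x′ = x≡x′
  ... | no x≢x′ = ⊥-elim (charges-disjoint x≢x′ charge charge′)
    where
    charges-disjoint : ∀ {t} → x ≢ x′ → LeafCharge x t ⊎ SideCharge x t → ¬ (LeafCharge x′ t ⊎ SideCharge x′ t)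
    charges-disjoint x≢x′ (inj₁ (_ , x~h , leaf-h , _)) (inj₁ (_ , x′~h , _ , _)) = x≢x′ (leaf-neighbour-unique leaf-h (~-sym x~h) (~-sym x′~h))
    charges-disjoint _ (inj₁ leaf) (inj₂ side′) = LeafCharge-SideCharge-disjoint tminus-x tminus-x′ leaf side′
    charges-disjoint _ (inj₂ side) (inj₁ leaf′) = LeafCharge-SideCharge-disjoint tminus-x′ tminus-x leaf′ side
    charges-disjoint x≢x′ (inj₂ side) (inj₂ side′) = SideCharges-disjoint x≢x′ tminus-x tminus-x′ side side′

  edgeSlots : Bool → List Slot
  edgeSlots s = concatMap (λ u → concatMap (edgeSlotsAt s u) (allFin n)) (allFin n)

  length-edgeSlots : ∀ s → length (edgeSlots s) ≡ numEdges G
  length-edgeSlots s = trans (length-concatMap _ (allFin n))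
    (cong sum (map-cong (λ u → length-concatMap-allFin (edgeSlotsAt s u) (isEdgeᵇ u) (length-edgeSlotsAt s u)) (allFin n)))

  ∈-edgeSlots : ∀ {s t} → t ∈ edgeSlots s → (∃[ u ] ∃[ v ] EdgeCharge u v (proj₁ t)) × proj₂ t ≡ s
  ∈-edgeSlots {s} t∈ with ∈-concatMap-allFin⁻ _ t∈
  ... | u , t∈u with ∈-concatMap-allFin⁻ (edgeSlotsAt s u) t∈u
  ...   | v , t∈uv = let charge , bit≡s = ∈-edgeSlotsAt u v t∈uv in (u , v , charge) , bit≡s

  Unique-edgeSlots : ∀ s → Unique (edgeSlots s)
  Unique-edgeSlots s = Unique-concatMap-allFin _ (λ u → Unique-concatMap-allFin _ (Unique-edgeSlotsAt s u) same-v) same-u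
    where
    same-v : ∀ {u v v′ t} → t ∈ edgeSlotsAt s u v → t ∈ edgeSlotsAt s u v′ → v ≡ v′
    same-v {u} {v} {v′} t∈ t∈′ = proj₂ (EdgeCharge-injective (proj₁ (∈-edgeSlotsAt u v t∈)) (proj₁ (∈-edgeSlotsAt u v′ t∈′)))
    same-u : ∀ {u u′ t} → t ∈ concatMap (edgeSlotsAt s u) (allFin n) → t ∈ concatMap (edgeSlotsAt s u′) (allFin n) → u ≡ u′
    same-u {u} {u′} t∈ t∈′ with ∈-concatMap-allFin⁻ (edgeSlotsAt s u) t∈ | ∈-concatMap-allFin⁻ (edgeSlotsAt s u′) t∈′
    ... | v , t∈uv | v′ , t∈u′v′ = proj₁ (EdgeCharge-injective (proj₁ (∈-edgeSlotsAt u v t∈uv)) (proj₁ (∈-edgeSlotsAt u′ v′ t∈u′v′)))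

  tminusSlotsAt : ∀ x → Dec (TminusLeaf x) → List Slot
  tminusSlotsAt x (yes tminus-x) = [ proj₁ (tminus-charge tminus-x) ]
  tminusSlotsAt x (no _) = []

  tminusSlots : List Slot
  tminusSlots = concatMap (λ x → tminusSlotsAt x (T? (tminusLeafᵇ x))) (allFin n)

  length-tminusSlotsAt : ∀ x (d : Dec (TminusLeaf x)) → length (tminusSlotsAt x d) ≡ (if does d then 1 else 0)
  length-tminusSlotsAt x (yes _) = refl
  length-tminusSlotsAt x (no _) = refl

  length-tminusSlots : length tminusSlots ≡ ell G
  length-tminusSlots = trans (length-concatMap-allFin _ tminusLeafᵇ (λ x → length-tminusSlotsAt x (T? (tminusLeafᵇ x))))
                                (sym ell≡count-tminusLeaf)

  ∈-tminusSlotsAt : ∀ {x t} (d : Dec (TminusLeaf x)) → t ∈ tminusSlotsAt x d → TminusLeaf x × TminusCharge x t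
  ∈-tminusSlotsAt (yes tminus-x) (here refl) = tminus-x , proj₂ (tminus-charge tminus-x)

  ∈-tminusSlots : ∀ {t} → t ∈ tminusSlots → ∃[ x ] TminusLeaf x × TminusCharge x t
  ∈-tminusSlots t∈ with ∈-concatMap-allFin⁻ _ t∈
  ... | x , t∈x = x , ∈-tminusSlotsAt _ t∈x

  Unique-tminusSlots : Unique tminusSlots
  Unique-tminusSlots = Unique-concatMap-allFin _ (λ x → at-most-one (T? (tminusLeafᵇ x))) same-x
    where
    at-most-one : ∀ {x} (d : Dec (TminusLeaf x)) → Unique (tminusSlotsAt x d)
    at-most-one (yes _) = [] ∷ []
    at-most-one (no _) = []
    same-x : ∀ {x x′ t} → t ∈ tminusSlotsAt x (T? (tminusLeafᵇ x)) → t ∈ tminusSlotsAt x′ (T? (tminusLeafᵇ x′)) → x ≡ x′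
    same-x t∈ t∈′ with ∈-tminusSlotsAt _ t∈ | ∈-tminusSlotsAt _ t∈′
    ... | tminus-x , charge | tminus-x′ , charge′ = TminusCharge-injective tminus-x tminus-x′ charge charge′

  chargedSlots : List Slot
  chargedSlots = edgeSlots false ++ edgeSlots true ++ tminusSlots

  length-chargedSlots : length chargedSlots ≡ numEdges G + numEdges G + ell G
  length-chargedSlots = begin
    length chargedSlots
      ≡⟨ length-++ (edgeSlots false) ⟩
    length (edgeSlots false) + length (edgeSlots true ++ tminusSlots)
      ≡⟨ cong (length (edgeSlots false) +_) (length-++ (edgeSlots true)) ⟩
    length (edgeSlots false) + (length (edgeSlots true) + length tminusSlots)
      ≡⟨ cong₂ _+_ (length-edgeSlots false) (cong₂ _+_ (length-edgeSlots true) length-tminusSlots) ⟩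
    numEdges G + (numEdges G + ell G)
      ≡⟨ +-assoc (numEdges G) _ _ ⟨
    numEdges G + numEdges G + ell G
      ∎
    where open ≡-Reasoning

  Unique-chargedSlots : Unique chargedSlots
  Unique-chargedSlots =
    ++⁺ (Unique-edgeSlots false) (++⁺ (Unique-edgeSlots true) Unique-tminusSlots edge-tminus-disjoint) false-rest-disjoint
    where
    edge-tminus-disjoint : ∀ {s} → Disjoint (edgeSlots s) tminusSlots
    edge-tminus-disjoint (t∈edge , t∈tminus) =
      let (_ , _ , edge) , _ = ∈-edgeSlots t∈edge
          _ , _ , _ , charge = ∈-tminusSlots t∈tminus
      in EdgeCharge-TminusCharge-disjoint edge charge
    false-true-disjoint : Disjoint (edgeSlots false) (edgeSlots true)
    false-true-disjoint (t∈false , t∈true) = contradiction (trans (sym (proj₂ (∈-edgeSlots t∈false))) (proj₂ (∈-edgeSlots t∈true))) λ ()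
    false-rest-disjoint : Disjoint (edgeSlots false) (edgeSlots true ++ tminusSlots)
    false-rest-disjoint (t∈false , t∈rest) =
      [ (λ t∈true → false-true-disjoint (t∈false , t∈true)) , (λ t∈tminus → edge-tminus-disjoint (t∈false , t∈tminus)) ]′
        (∈-++⁻ (edgeSlots true) t∈rest)

  allSlots : List Slot
  allSlots = map (_, false) H ++ map (_, true) H

  length-allSlots : length allSlots ≡ length H + length H
  length-allSlots = trans (length-++ (map (_, false) H)) (cong₂ _+_ (length-map (_, false) H) (length-map (_, true) H))

  ∈-allSlots : ∀ {t} → proj₁ t ∈ H → t ∈ allSlots
  ∈-allSlots {e , false} e∈H = ∈-++⁺ˡ (∈-map⁺ (_, false) e∈H)
  ∈-allSlots {e , true} e∈H = ∈-++⁺ʳ (map (_, false) H) (∈-map⁺ (_, true) e∈H)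

  chargedSlots⊆allSlots : ∀ {t} → t ∈ chargedSlots → t ∈ allSlots
  chargedSlots⊆allSlots t∈ = ∈-allSlots (charged-arc t∈)
    where
    edge-arc : ∀ {s t} → t ∈ edgeSlots s → proj₁ t ∈ H
    edge-arc t∈ = let (_ , _ , charge) , _ = ∈-edgeSlots t∈ in proj₁ (chosen-sound (EdgeCharge.chosen≡ charge))
    charged-arc : ∀ {t} → t ∈ chargedSlots → proj₁ t ∈ H
    charged-arc t∈ with ∈-++⁻ (edgeSlots false) t∈
    ... | inj₁ t∈false = edge-arc t∈false
    ... | inj₂ t∈rest with ∈-++⁻ (edgeSlots true) t∈rest
    ...   | inj₁ t∈true = edge-arc t∈true
    ...   | inj₂ t∈tminus = let _ , _ , e∈H , _ = ∈-tminusSlots t∈tminus in e∈H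

  hydra-bound : numEdges G + ⌈ ell G /2⌉ ≤ length H
  hydra-bound = m+m+n≤k+k⇒m+⌈n/2⌉≤k (numEdges G) (ell G) (length H)
    (subst₂ _≤_ length-chargedSlots length-allSlots (Unique-⊆⇒length≤ Unique-chargedSlots chargedSlots⊆allSlots))

theorem6p2 : ∀ {n : ℕ} (T : Graph n) → IsTree T → ¬ IsStar T →
    ∀ (H : Hypergraph n) → NoDupArcs H → Represents H T →
    numEdges T + ⌈ ell T /2⌉ ≤ length H
-- ¬ IsStar only refutes ¬ HasP3, but the bound is decidable, so we argue by contradiction.
theorem6p2 T (conn , acyclic) ¬star H _ rep = decidable-stable (_ ≤? _) λ ¬bound →
  ¬star ((conn , acyclic) , λ p3 →
    let b , c , b~c , ¬leaf-b , ¬leaf-c = GraphFacts.HasP3⇒nonleaf-edge T p3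
    in ¬bound (Charging.hydra-bound conn acyclic b~c ¬leaf-b ¬leaf-c rep))
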